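{- Let $G=(D\cup I,E)$ be a split graph and let $k=\chi_p^2(H(G))$. Then $G$ does not have $k+2$ completely independent spanning trees.
   Context: A split graph $G=(D\cup I,E)$ is a graph whose vertex set is partitioned into a clique $D$ and an independent set $I$; the paper assumes throughout that every vertex of $D$ is adjacent to at least one vertex of $I$. Its corresponding hypergraph is $H(G)=(D,\mathcal{E})$ with $\mathcal{E}=\{N_G(x) : x\in I\}$ (one hyperedge for each $x\in I$). A panchromatic $k$-coloring of a hypergraph is an assignment of colors from $\{1,\dots,k\}$ to its vertices such that every hyperedge contains at least one vertex of each of the $k$ colors; it is bipanchromatic if each of the $k$ colors is assigned to at least two vertices. The bipanchromatic number $\chi_p^2(H)$ is the maximum $k$ such that $H$ admits a bipanchromatic $k$-coloring. Spanning trees $T_1,\dots,T_m$ of a graph are completely independent spanning trees if for every pair of vertices $x,y$ the $(x,y)$-paths in $T_1,\dots,T_m$ are pairwise edge-disjoint and have no common internal vertex. -}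

module Defs where

open import Data.Nat using (ℕ; _≤_; _≥_)
open import Data.Fin using (Fin)
open import Data.Bool using (Bool; true; false; T)
open import Data.List using (List; []; _∷_; length)
open import Data.List.Membership.Propositional using (_∈_)
open import Data.List.Relation.Unary.Unique.Propositional using (Unique)
open import Data.Product using (Σ; ∃; _×_; proj₁)
open import Data.Sum using (_⊎_)
open import Relation.Nullary using (¬_)
open import Relation.Binary.PropositionalEquality using (_≡_; _≢_)

record Graph (n : ℕ) : Set where
  field
    adj    : Fin n → Fin n → Bool
    sym    : ∀ u v → T (adj u v) → T (adj v u)
    irrefl : ∀ v → ¬ T (adj v v)

  Edge : Fin n → Fin n → Set
  Edge u v = T (adj u v)

open Graph public

module _ {n : ℕ} (R : Fin n → Fin n → Set) where

  data Walk : Fin n → Fin n → List (Fin n) → Set where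
    stop : ∀ {x} → Walk x x (x ∷ [])
    step : ∀ {x z y ps} → R x z → Walk z y ps → Walk x y (x ∷ ps)

  IsPath : Fin n → Fin n → List (Fin n) → Set
  IsPath x y ps = Walk x y ps × Unique ps

data Consec {n : ℕ} (u v : Fin n) : List (Fin n) → Set where
  here  : ∀ {ps} → Consec u v (u ∷ v ∷ ps)
  there : ∀ {w ps} → Consec u v ps → Consec u v (w ∷ ps)

EdgeOf : ∀ {n} → Fin n → Fin n → List (Fin n) → Set
EdgeOf u v ps = Consec u v ps ⊎ Consec v u ps

record SpanningTree {n : ℕ} (G : Graph n) : Set where
  field
    tadj  : Fin n → Fin n → Bool
    tsym  : ∀ u v → T (tadj u v) → T (tadj v u)
    sub   : ∀ u v → T (tadj u v) → Edge G u v
    connected : ∀ x y → ∃ λ ps → IsPath (λ u v → T (tadj u v)) x y ps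
    acyclic : ∀ x y ps → IsPath (λ u v → T (tadj u v)) x y ps →
              length ps ≥ 3 → ¬ T (tadj y x)

  TEdge : Fin n → Fin n → Set
  TEdge u v = T (tadj u v)

open SpanningTree public

CompletelyIndependent : ∀ {n} {G : Graph n} {m : ℕ} → (Fin m → SpanningTree G) → Set
CompletelyIndependent {n} {G} {m} Ts =
  ∀ (i j : Fin m) → i ≢ j → ∀ (x y : Fin n) (P Q : List (Fin n)) →
    IsPath (TEdge (Ts i)) x y P → IsPath (TEdge (Ts j)) x y Q →
    (∀ u v → EdgeOf u v P → ¬ EdgeOf u v Q) ×
    (∀ w → w ∈ P → w ∈ Q → w ≢ x → w ≢ y → ⊥')
  where open import Data.Empty renaming (⊥ to ⊥')

HasCISTs : ∀ {n} → Graph n → ℕ → Set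
HasCISTs G m = Σ (Fin m → SpanningTree G) CompletelyIndependent

record SplitGraph (n : ℕ) : Set where
  field
    graph : Graph n
    inD   : Fin n → Bool
    clique : ∀ u v → u ≢ v → inD u ≡ true → inD v ≡ true → Edge graph u v
    indep  : ∀ u v → inD u ≡ false → inD v ≡ false → ¬ Edge graph u v
    dom    : ∀ v → inD v ≡ true → ∃ λ x → inD x ≡ false × Edge graph v x

open SplitGraph public

record Hypergraph : Set₁ where
  field
    V    : Set
    Ix   : Set
    _∈ₕ_ : V → Ix → Set

open Hypergraph public

Panchromatic : (H : Hypergraph) (k : ℕ) → (V H → Fin k) → Set
Panchromatic H k c = ∀ (e : Ix H) (j : Fin k) → ∃ λ v → _∈ₕ_ H v e × c v ≡ j

Bipanchromatic : (H : Hypergraph) (k : ℕ) → (V H → Fin k) → Set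
Bipanchromatic H k c =
  Panchromatic H k c ×
  (∀ (j : Fin k) → ∃ λ v → ∃ λ w → v ≢ w × c v ≡ j × c w ≡ j)

HasBipanchromatic : Hypergraph → ℕ → Set
HasBipanchromatic H k = Σ (V H → Fin k) (Bipanchromatic H k)

IsBipanchromaticNumber : Hypergraph → ℕ → Set
IsBipanchromaticNumber H k =
  HasBipanchromatic H k × (∀ k' → HasBipanchromatic H k' → k' ≤ k)

-- H(G) = (D, {N_G(x) : x ∈ I})
splitHypergraph : ∀ {n} → SplitGraph n → Hypergraph
splitHypergraph {n} S = record
  { V    = Σ (Fin n) (λ v → inD S v ≡ true)
  ; Ix   = Σ (Fin n) (λ x → inD S x ≡ false)
  ; _∈ₕ_ = λ d x → Edge (graph S) (proj₁ x) (proj₁ d)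
  }

{-# OPTIONS --safe #-}
-- Let T₁, …, T_{k+2} be completely independent spanning trees of G.  No vertex is
-- internal in two of them: deleting it would separate two of its neighbours in both
-- trees.  Every vertex has an internal neighbour in every tree, otherwise it is the
-- centre of a star and shares an edge with any other tree; so each N(x), x ∈ I,
-- contains an internal vertex of every tree, necessarily in D.  If two trees each had
-- at most one internal vertex in D, these two vertices would be adjacent in both trees.
-- Hence all trees but one have two internal vertices in D, and colouring D by the
-- remaining k + 1 trees is a bipanchromatic (k + 1)-colouring of H(G).
module Submission where

open import Defs
open import Data.Nat using (ℕ; _≥_; _+_; suc; s≤s; z≤n; _≤_; _<_)
open import Data.Nat.Properties using (+-comm; 1+n≰n; ≤-trans)
open import Data.Bool using (true; false)
open import Data.Bool.Properties using () renaming (_≟_ to _≟ᵇ_)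
open import Data.Fin using (Fin; zero; punchIn)
open import Data.Fin.Properties using (_≟_; any?; punchInᵢ≢i; punchIn-injective)
open import Data.List using (List; []; _∷_; length)
open import Data.List.Membership.Propositional using (_∈_; _∉_)
open import Data.List.Relation.Unary.Any as Any using (here; there)
open import Data.List.Relation.Unary.All using (All; []; _∷_)
open import Data.List.Relation.Unary.All.Properties using (¬Any⇒All¬)
open import Data.List.Relation.Unary.AllPairs using ([]; _∷_)
open import Data.Product using (∃; ∃₂; _×_; _,_; proj₁; proj₂)
open import Data.Sum using (_⊎_; inj₁; inj₂; [_,_]′)
open import Data.Empty using (⊥; ⊥-elim)
open import Function using (_∘_; id)
open import Relation.Binary.Definitions using (Symmetric; Transitive)
open import Relation.Binary.Construct.Closure.ReflexiveTransitive as Star using (Star; ε; _◅_; _◅◅_)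
open import Relation.Nullary using (¬_; Dec; yes; no; ¬?; _×-dec_)
open import Relation.Nullary.Decidable using (T?; decidable-stable; ¬¬-excluded-middle)
open import Relation.Binary.PropositionalEquality using (_≡_; _≢_; refl; ≢-sym; cong; subst)

another : ∀ {n} → 2 ≤ n → (x : Fin n) → ∃ λ w → x ≢ w
another (s≤s (s≤s _)) x = punchIn x zero , ≢-sym (punchInᵢ≢i x zero)

all-but-one : ∀ {m} {P : Fin (suc m) → Set} → (∀ i → Dec (P i)) →
              (∀ {i j} → i ≢ j → ¬ P i → ¬ P j → ⊥) → ∃ λ j₀ → ∀ i → i ≢ j₀ → P i
all-but-one P? at-most-one-fails with any? (¬? ∘ P?)
... | yes (j₀ , ¬Pj₀) = j₀ , λ i i≢j₀ →
  decidable-stable (P? i) λ ¬Pi → at-most-one-fails i≢j₀ ¬Pi ¬Pj₀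
... | no ∄¬P = zero , λ i _ → decidable-stable (P? i) λ ¬Pi → ∄¬P (i , ¬Pi)

module _ {a ℓ} {A : Set a} {_∼_ : A → A → Set ℓ}
         (∼-sym : Symmetric _∼_) (∼-trans : Transitive _∼_) where

  ¬¬-inequivalent-to-one : ∀ {p} (P : A → Set p) {x y} → P x → P y → ¬ x ∼ y →
                           ∀ z → ¬ ¬ (∃ λ w → P w × ¬ z ∼ w)
  ¬¬-inequivalent-to-one P {x} {y} px py x≁y z k = ¬¬-excluded-middle {A = z ∼ x} λ
    { (yes z∼x) → k (y , py , λ z∼y → x≁y (∼-trans (∼-sym z∼x) z∼y))
    ; (no z≁x)  → k (x , px , z≁x) }

ConnectedAvoiding : ∀ {n} → (Fin n → Fin n → Set) → Fin n → Fin n → Fin n → Set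
ConnectedAvoiding R v = Star (λ a b → R a b × v ≢ a × v ≢ b)

module _ {n} {R : Fin n → Fin n → Set} where

  All-head : ∀ {p} {P : Fin n → Set p} {x y ps} → Walk R x y ps → All P ps → P x
  All-head stop       (px ∷ _) = px
  All-head (step _ _) (px ∷ _) = px

  walk-length : ∀ {x y ps} → Walk R x y ps → x ≢ y → 2 ≤ length ps
  walk-length stop                x≢x = ⊥-elim (x≢x refl)
  walk-length (step _ stop)       _   = s≤s (s≤s z≤n)
  walk-length (step _ (step _ _)) _   = s≤s (s≤s z≤n)

  edge-path : ∀ {u v} → R u v → u ≢ v → IsPath R u v (u ∷ v ∷ [])
  edge-path r u≢v = step r stop , (u≢v ∷ []) ∷ [] ∷ []

  path-suffix : ∀ {P : Fin n → Set} {x z y ps} → IsPath R z y ps → All P ps → x ∈ ps →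
                ∃ λ qs → IsPath R x y qs × All P qs
  path-suffix path@(stop , _)     Pps (here refl) = _ , path , Pps
  path-suffix path@(step _ _ , _) Pps (here refl) = _ , path , Pps
  path-suffix (stop , _) _ (there ())
  path-suffix (step _ w , _ ∷ u) (_ ∷ Pps) (there x∈ps) = path-suffix (w , u) Pps x∈ps

  walk⇒connectedAvoiding : ∀ {v x y ps} → Walk R x y ps → v ∉ ps → ConnectedAvoiding R v x y
  walk⇒connectedAvoiding {v} {ps = ps} w v∉ps = go w (¬Any⇒All¬ ps v∉ps)
    where
    go : ∀ {x y ps} → Walk R x y ps → All (v ≢_) ps → ConnectedAvoiding R v x y
    go stop       _            = ε
    go (step r w) (v≢x ∷ v∉ps) = (r , v≢x , All-head w v∉ps) ◅ go w v∉ps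

  -- Loop erasure: cut back to x if it already lies on the path.
  connectedAvoiding⇒path : ∀ {v x y} → ConnectedAvoiding R v x y → v ≢ x →
                           ∃ λ ps → IsPath R x y ps × All (v ≢_) ps
  connectedAvoiding⇒path ε v≢x = _ , (stop , [] ∷ []) , v≢x ∷ []
  connectedAvoiding⇒path {x = x} ((r , v≢x , v≢z) ◅ c) _ with connectedAvoiding⇒path c v≢z
  ... | ps , (w , u) , v∉ps with Any.any? (x ≟_) ps
  ...   | yes x∈ps = path-suffix (w , u) v∉ps x∈ps
  ...   | no x∉ps  = x ∷ ps , (step r w , ¬Any⇒All¬ ps x∉ps ∷ u) , v≢x ∷ v∉ps

  connectedAvoiding-sym : Symmetric R → ∀ {v} → Symmetric (ConnectedAvoiding R v)
  connectedAvoiding-sym R-sym = Star.reverse λ (r , v≢a , v≢b) → R-sym r , v≢b , v≢a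

module _ {n} {G : Graph n} (T : SpanningTree G) where

  TEdge-sym : Symmetric (TEdge T)
  TEdge-sym = tsym T _ _

  TEdge-irrefl : ∀ {u v} → TEdge T u v → u ≢ v
  TEdge-irrefl {u} e refl = irrefl G u (sub T u u e)

  Internal : Fin n → Set
  Internal v = ∃₂ λ a b → a ≢ b × TEdge T v a × TEdge T v b

  InternalNeighbour : Fin n → Set
  InternalNeighbour x = ∃ λ u → TEdge T x u × Internal u

  internal? : ∀ v → Dec (Internal v)
  internal? v = any? λ a → any? λ b → ¬? (a ≟ b) ×-dec T? (tadj T v a) ×-dec T? (tadj T v b)

  internalNeighbour? : ∀ x → Dec (InternalNeighbour x)
  internalNeighbour? x = any? λ u → T? (tadj T x u) ×-dec internal? u

  -- The second vertex of the tree path from x to w is internal.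
  adjacent-or-internalNeighbour : ∀ {x w} → x ≢ w → TEdge T x w ⊎ InternalNeighbour x
  adjacent-or-internalNeighbour {x} {w} x≢w with connected T x w
  ... | _ , stop , _ = ⊥-elim (x≢w refl)
  ... | _ , step xw stop , _ = inj₁ xw
  ... | _ , step {z = u} xu (step {z = b} ub p) , ((_ ∷ x∉ps) ∷ _) =
    inj₂ (u , xu , x , b , All-head p x∉ps , TEdge-sym xu , ub)

  star-centre : ∀ {x u} → ¬ InternalNeighbour x → x ≢ u → TEdge T x u
  star-centre ¬nx x≢u = [ id , ⊥-elim ∘ ¬nx ]′ (adjacent-or-internalNeighbour x≢u)

  -- A path from a to b avoiding v closes a cycle through the edges va and vb.
  neighbours-disconnected : ∀ {v a b} → a ≢ b → TEdge T v a → TEdge T v b →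
                            ¬ ConnectedAvoiding (TEdge T) v a b
  neighbours-disconnected {v} {a} {b} a≢b va vb c with connectedAvoiding⇒path c (TEdge-irrefl va)
  ... | ps , (p , u) , v∉ps =
    acyclic T v b (v ∷ ps) (step va p , v∉ps ∷ u) (s≤s (walk-length p a≢b)) (TEdge-sym vb)

-- A record, so that T and U can be inferred from a proof of independence.
record Independent {n} {G : Graph n} (T U : SpanningTree G) : Set where
  constructor independent
  field
    paths-independent :
      ∀ (x y : Fin n) (P Q : List (Fin n)) →
        IsPath (TEdge T) x y P → IsPath (TEdge U) x y Q →
        (∀ u v → EdgeOf u v P → ¬ EdgeOf u v Q) ×
        (∀ w → w ∈ P → w ∈ Q → w ≢ x → w ≢ y → ⊥)

independent-sym : ∀ {n} {G : Graph n} {T U : SpanningTree G} → Independent T U → Independent U T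
independent-sym (independent T⊥U) = independent λ x y P Q p q →
  (λ u v uvP uvQ → proj₁ (T⊥U x y Q P q p) u v uvQ uvP) ,
  (λ w w∈P w∈Q → proj₂ (T⊥U x y Q P q p) w w∈Q w∈P)

cists-independent : ∀ {n} {G : Graph n} {m} ((Ts , _) : HasCISTs G m) →
                    ∀ {i j} → i ≢ j → Independent (Ts i) (Ts j)
cists-independent (_ , indep) {i} {j} i≢j = independent (indep i j i≢j)

module _ {n} {G : Graph n} {T U : SpanningTree G} (T⊥U : Independent T U) where

  open Independent T⊥U

  edge-disjoint : ∀ {u v} → TEdge T u v → ¬ TEdge U u v
  edge-disjoint {u} {v} uvT uvU =
    proj₁ (paths-independent u v _ _ (edge-path uvT (TEdge-irrefl T uvT))
                                     (edge-path uvU (TEdge-irrefl U uvU)))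
      u v (inj₁ here) (inj₁ here)

  -- Otherwise the T-path from c to e and the U-path c v e share the internal vertex v.
  connectedAvoiding-other-neighbours : ∀ {v c e} → c ≢ e → TEdge U v c → TEdge U v e →
                                       ConnectedAvoiding (TEdge T) v c e
  connectedAvoiding-other-neighbours {v} {c} {e} c≢e vc ve with connected T c e
  ... | P , p , uP with Any.any? (v ≟_) P
  ...   | no v∉P  = walk⇒connectedAvoiding p v∉P
  ...   | yes v∈P =
    ⊥-elim (proj₂ (paths-independent c e P _ (p , uP) cve) v v∈P (there (here refl)) v≢c v≢e)
    where
    v≢c : v ≢ c
    v≢c = TEdge-irrefl U vc
    v≢e : v ≢ e
    v≢e = TEdge-irrefl U ve
    cve : IsPath (TEdge U) c e (c ∷ v ∷ e ∷ [])
    cve = step (TEdge-sym U vc) (step ve stop) ,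
          (≢-sym v≢c ∷ c≢e ∷ []) ∷ (v≢e ∷ []) ∷ [] ∷ []

  connectedAvoiding-in-one : ∀ {v x y} → v ≢ x → v ≢ y →
                             ConnectedAvoiding (TEdge T) v x y ⊎ ConnectedAvoiding (TEdge U) v x y
  connectedAvoiding-in-one {v} {x} {y} v≢x v≢y with connected T x y | connected U x y
  ... | P , p | Q , q with Any.any? (v ≟_) P | Any.any? (v ≟_) Q
  ...   | no v∉P  | _        = inj₁ (walk⇒connectedAvoiding (proj₁ p) v∉P)
  ...   | yes _   | no v∉Q   = inj₂ (walk⇒connectedAvoiding (proj₁ q) v∉Q)
  ...   | yes v∈P | yes v∈Q  = ⊥-elim (proj₂ (paths-independent x y P Q p q) v v∈P v∈Q v≢x v≢y)

  -- In T - v the T-neighbours a, b of v are separated while the U-neighbours c, e are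
  -- joined; in U - v, c and e are separated.  This yields p ∈ {a, b} and q ∈ {c, e}
  -- lying in different components of both T - v and U - v.
  internal-in-at-most-one : ∀ {v} → Internal T v → ¬ Internal U v
  internal-in-at-most-one {v} (a , b , a≢b , va , vb) (c , e , c≢e , vc , ve) =
    ¬¬-inequivalent-to-one ∼T-sym _◅◅_ (v ≢_) (TEdge-irrefl T va) (TEdge-irrefl T vb)
      (neighbours-disconnected T a≢b va vb) c λ (p , v≢p , c≁p) →
    ¬¬-inequivalent-to-one ∼U-sym _◅◅_ (λ w → v ≢ w × ¬ ConnectedAvoiding (TEdge T) v p w)
      (TEdge-irrefl U vc , c≁p ∘ ∼T-sym) (TEdge-irrefl U ve , λ p∼e → c≁p (c∼e ◅◅ ∼T-sym p∼e))
      (neighbours-disconnected U c≢e vc ve) p λ (q , (v≢q , p≁ₜq) , p≁ᵤq) →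
    [ p≁ₜq , p≁ᵤq ]′ (connectedAvoiding-in-one v≢p v≢q)
    where
    ∼T-sym : Symmetric (ConnectedAvoiding (TEdge T) v)
    ∼T-sym = connectedAvoiding-sym (TEdge-sym T)
    ∼U-sym : Symmetric (ConnectedAvoiding (TEdge U) v)
    ∼U-sym = connectedAvoiding-sym (TEdge-sym U)
    c∼e : ConnectedAvoiding (TEdge T) v c e
    c∼e = connectedAvoiding-other-neighbours c≢e vc ve

  -- Otherwise x is the centre of the star T, so it shares an edge of U.
  internalNeighbour : ∀ {x w} → x ≢ w → InternalNeighbour T x
  internalNeighbour {x} x≢w = decidable-stable (internalNeighbour? T x) λ ¬nx →
    [ edge-disjoint (star-centre T ¬nx x≢w)
    , (λ (u , xu , _) → edge-disjoint (star-centre T ¬nx (TEdge-irrefl U xu)) xu) ]′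
    (adjacent-or-internalNeighbour U x≢w)

module _ {n} (S : SplitGraph n) where

  neighbour-of-I-in-D : ∀ {x u} → inD S x ≡ false → Edge (graph S) x u → inD S u ≡ true
  neighbour-of-I-in-D {x} {u} x∈I xu with inD S u in u∈?
  ... | true  = refl
  ... | false = ⊥-elim (indep S x u x∈I u∈? xu)

  some-vertex-in-I : 0 < n → ∃ λ x → inD S x ≡ false
  some-vertex-in-I (s≤s _) with inD S zero in zero∈?
  ... | false = zero , zero∈?
  ... | true with dom S zero zero∈?
  ...   | x , x∈I , _ = x , x∈I

  TwoInternalInD : SpanningTree (graph S) → Set
  TwoInternalInD T = ∃₂ λ d₁ d₂ → d₁ ≢ d₂ × inD S d₁ ≡ true × inD S d₂ ≡ true ×
                                   Internal T d₁ × Internal T d₂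

  twoInternalInD? : ∀ T → Dec (TwoInternalInD T)
  twoInternalInD? T = any? λ d₁ → any? λ d₂ →
    ¬? (d₁ ≟ d₂) ×-dec inD S d₁ ≟ᵇ true ×-dec inD S d₂ ≟ᵇ true ×-dec
    internal? T d₁ ×-dec internal? T d₂

  internal-in-D-unique : ∀ T {a b} → ¬ TwoInternalInD T →
                         inD S a ≡ true → Internal T a → inD S b ≡ true → Internal T b → a ≡ b
  internal-in-D-unique T {a} {b} ¬two a∈D ia b∈D ib =
    decidable-stable (a ≟ b) λ a≢b → ¬two (a , b , a≢b , a∈D , b∈D , ia , ib)

  module _ (2≤n : 2 ≤ n) where

    internalNeighbour-in-D : ∀ {T U : SpanningTree (graph S)} {x} → Independent T U →
                             inD S x ≡ false → ∃ λ u → inD S u ≡ true × TEdge T x u × Internal T u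
    internalNeighbour-in-D {T} {x = x} T⊥U x∈I with internalNeighbour T⊥U (proj₂ (another 2≤n x))
    ... | u , xu , iu = u , neighbour-of-I-in-D x∈I (sub T x u xu) , xu , iu

    I-adjacent-to-sole-internal : ∀ {T U : SpanningTree (graph S)} {a y} → Independent T U →
                                  ¬ TwoInternalInD T → inD S a ≡ true → Internal T a →
                                  inD S y ≡ false → TEdge T y a
    I-adjacent-to-sole-internal {T} {y = y} T⊥U ¬two a∈D ia y∈I with internalNeighbour-in-D T⊥U y∈I
    ... | u , u∈D , yu , iu = subst (TEdge T y) (internal-in-D-unique T ¬two u∈D iu a∈D ia) yu

    other-internal-adjacent-to-sole-internal :
      ∀ {T U : SpanningTree (graph S)} {a b} → Independent T U →
      ¬ TwoInternalInD T → ¬ TwoInternalInD U →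
      inD S a ≡ true → Internal T a → inD S b ≡ true → Internal U b → b ≢ a → TEdge T b a
    other-internal-adjacent-to-sole-internal {T} {U} {a} {b} T⊥U ¬twoT ¬twoU a∈D ia b∈D ib b≢a
      with adjacent-or-internalNeighbour T b≢a
    ... | inj₁ ba = ba
    ... | inj₂ (u , bu , iu) with inD S u in u∈?
    ...   | true  = subst (TEdge T b) (internal-in-D-unique T ¬twoT u∈? iu a∈D ia) bu
    ...   | false = ⊥-elim (edge-disjoint T⊥U (TEdge-sym T bu)
                      (I-adjacent-to-sole-internal (independent-sym T⊥U) ¬twoU b∈D ib u∈?))

    not-both-without-two-internal : ∀ {T U : SpanningTree (graph S)} → Independent T U →
                                    ¬ TwoInternalInD T → ¬ TwoInternalInD U → ⊥
    not-both-without-two-internal {T} {U} T⊥U ¬twoT ¬twoU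
      with some-vertex-in-I (≤-trans (s≤s z≤n) 2≤n)
    ... | x₀ , x₀∈I with internalNeighbour-in-D T⊥U x₀∈I
                       | internalNeighbour-in-D (independent-sym T⊥U) x₀∈I
    ...   | a , a∈D , _ , ia | b , b∈D , _ , ib = edge-disjoint T⊥U ba (TEdge-sym U ab)
      where
      b≢a : b ≢ a
      b≢a refl = internal-in-at-most-one T⊥U ia ib
      ba : TEdge T b a
      ba = other-internal-adjacent-to-sole-internal T⊥U ¬twoT ¬twoU a∈D ia b∈D ib b≢a
      ab : TEdge U a b
      ab = other-internal-adjacent-to-sole-internal (independent-sym T⊥U) ¬twoU ¬twoT
             b∈D ib a∈D ia (≢-sym b≢a)

module _ (H : Hypergraph) {k} (C : Fin (suc k) → V H → Set) (C? : ∀ j v → Dec (C j v))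
         (C-disjoint : ∀ v {i j} → C i v → C j v → i ≡ j) where

  colour : V H → Fin (suc k)
  colour v with any? (λ j → C? j v)
  ... | yes (j , _) = j
  ... | no _        = zero

  colour-of-class : ∀ {j v} → C j v → colour v ≡ j
  colour-of-class {j} {v} cj with any? (λ j → C? j v)
  ... | yes (i , ci) = C-disjoint v ci cj
  ... | no ∄c        = ⊥-elim (∄c (j , cj))

  classes⇒bipanchromatic : (∀ e j → ∃ λ v → _∈ₕ_ H v e × C j v) →
                           (∀ j → ∃₂ λ v w → v ≢ w × C j v × C j w) →
                           HasBipanchromatic H (suc k)
  classes⇒bipanchromatic hits twice = colour , panchromatic , bichromatic
    where
    panchromatic : Panchromatic H (suc k) colour
    panchromatic e j with hits e j
    ... | v , v∈e , cv = v , v∈e , colour-of-class cv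
    bichromatic : ∀ j → ∃₂ λ v w → v ≢ w × colour v ≡ j × colour w ≡ j
    bichromatic j with twice j
    ... | v , w , v≢w , cv , cw = v , w , v≢w , colour-of-class cv , colour-of-class cw

cists⇒bipanchromatic : ∀ {n k} → 2 ≤ n → (S : SplitGraph n) →
                       HasCISTs (graph S) (suc (suc k)) →
                       HasBipanchromatic (splitHypergraph S) (suc k)
cists⇒bipanchromatic {k = k} 2≤n S cists@(Ts , _)
  with all-but-one {P = λ i → TwoInternalInD S (Ts i)} (λ i → twoInternalInD? S (Ts i))
         (λ i≢j → not-both-without-two-internal S 2≤n (cists-independent cists i≢j))
... | j₀ , rich = classes⇒bipanchromatic (splitHypergraph S) C C? C-disjoint hits twice
  where
  independent-trees : ∀ {i j} → i ≢ j → Independent (Ts i) (Ts j)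
  independent-trees = cists-independent cists
  tree : Fin (suc k) → SpanningTree (graph S)
  tree j = Ts (punchIn j₀ j)
  C : Fin (suc k) → V (splitHypergraph S) → Set
  C j v = Internal (tree j) (proj₁ v)
  C? : ∀ j v → Dec (C j v)
  C? j v = internal? (tree j) (proj₁ v)
  C-disjoint : ∀ v {i j} → C i v → C j v → i ≡ j
  C-disjoint v {i} {j} ci cj = decidable-stable (i ≟ j) λ i≢j →
    internal-in-at-most-one (independent-trees (i≢j ∘ punchIn-injective j₀ i j)) {proj₁ v} ci cj
  hits : ∀ e j → ∃ λ v → _∈ₕ_ (splitHypergraph S) v e × C j v
  hits (x , x∈I) j with internalNeighbour-in-D S 2≤n (independent-trees (punchInᵢ≢i j₀ j)) x∈I
  ... | u , u∈D , xu , iu = (u , u∈D) , sub (tree j) x u xu , iu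
  twice : ∀ j → ∃₂ λ v w → v ≢ w × C j v × C j w
  twice j with rich (punchIn j₀ j) (punchInᵢ≢i j₀ j)
  ... | d₁ , d₂ , d₁≢d₂ , d₁∈D , d₂∈D , i₁ , i₂ =
    (d₁ , d₁∈D) , (d₂ , d₂∈D) , d₁≢d₂ ∘ cong proj₁ , i₁ , i₂

theorem7 : ∀ {n : ℕ} → n ≥ 2 → (S : SplitGraph n) (k : ℕ) →
    IsBipanchromaticNumber (splitHypergraph S) k →
    ¬ HasCISTs (graph S) (k + 2)
theorem7 2≤n S k (_ , maximal) cists =
  1+n≰n (maximal (suc k) (cists⇒bipanchromatic 2≤n S cists′))
  where
  cists′ : HasCISTs (graph S) (suc (suc k))
  cists′ = subst (HasCISTs (graph S)) (+-comm k 2) cists
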